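{- Assume that $|A_1|=3$ and $|A_2|=2$. Let $d\in A_1$ be such that $q(A_1)\subset\{q(d),\dots,q(d)+\ell(A_1)-1\}$, and let $d'\in A_2$. If one of the following conditions holds, then there is a multiplier $\lambda$ such that $q(\lambda\cdot A)\cap\{0,6\}=\emptyset$: (i) $\ell(A_1)\le 3$; (ii) $\ell(A_1)=4$ and $\tilde e(d,d')\in\{0,1,6\}$.
   Context: Fix an integer $m\ge 2$ and $N=7^{m+1}$. For an integer $x$ (or element of $\mathbb{Z}_N$), $q(x)\in\mathbb{Z}_7$ is the residue modulo $7$ of $\lfloor x/7^m\rfloor$ (depends only on $x$ mod $N$). A multiplier is an invertible element of $\mathbb{Z}_N$; $\lambda\cdot X=\{\lambda x:x\in X\}$. For $Y\subset\mathbb{Z}_7$, $\ell(Y)$ is the least $L\ge0$ with $Y\subseteq\{a,\dots,a+L-1\}$ (mod 7) for some $a$; for a set $X$ of integers, $\ell(X)=\ell(q(X))$. $A$ is a set of five integers, none divisible by $7$, with residues modulo $7$ in $\{1,2,4\}$; $s\in\{1,2,4\}$ is a residue attained by a maximum number of elements of $A$; $A_1,A_2,A_4$ are the elements of $A$ congruent to $s,2s,4s$ modulo $7$ respectively. For $d\in A_1$, $d'\in A_2$, $\tilde e(d,d')=2q(d)-q(d')\in\mathbb{Z}_7$. -}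

module Defs where

open import Data.Nat as ℕ using (ℕ; zero; suc; _∸_; _<_; _≤_; NonZero)
open import Data.Nat.Properties using (m^n≢0)
open import Data.Integer as ℤ using (ℤ; +_; _/ℕ_; _%ℕ_)
open import Data.Integer.Divisibility using () renaming (_∣_ to _∣ℤ_)
open import Data.List using (List; []; _∷_; filter; length; map; upTo)
open import Data.List.Relation.Unary.All using (All)
open import Data.List.Relation.Unary.Any using (Any)
open import Data.Bool using (Bool; true; false; if_then_else_; _∧_; _∨_)
open import Data.Product using (Σ)
open import Relation.Binary.PropositionalEquality using (_≡_)
open import Relation.Nullary.Decidable using (⌊_⌋)

Nmod : ℕ → ℕ
Nmod m = 7 ℕ.^ suc m

-- q(x) = ⌊x / 7^m⌋ mod 7, as a natural number in {0,…,6} (elements of ℤ_7)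
-- (_/ℕ_ on ℤ is floor division; _%ℕ_ gives the least nonnegative residue)
q : ℕ → ℤ → ℕ
q m x = ((x /ℕ (7 ℕ.^ m)) {{m^n≢0 7 m}}) %ℕ 7

res7 : ℤ → ℕ
res7 x = x %ℕ 7

Multiplier : ℕ → ℤ → Set
Multiplier m λ' = Σ ℤ (λ μ → (+ Nmod m) ∣ℤ (λ' ℤ.* μ ℤ.- ℤ.+ 1))

withRes : ℕ → List ℤ → List ℤ
withRes r A = filter (λ x → res7 x ℕ.≟ r) A

A₁ A₂ A₄ : ℕ → List ℤ → List ℤ
A₁ s A = withRes (s ℕ.% 7) A
A₂ s A = withRes ((2 ℕ.* s) ℕ.% 7) A
A₄ s A = withRes ((4 ℕ.* s) ℕ.% 7) A

-- y ∈ {a, a+1, …, a+L-1} (mod 7), for y, a ∈ {0,…,6}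
inIntvB : ℕ → ℕ → ℕ → Bool
inIntvB a L y = ⌊ ((y ℕ.+ 7) ∸ a) ℕ.% 7 ℕ.<? L ⌋

InIntv : ℕ → ℕ → ℕ → Set
InIntv a L y = inIntvB a L y ≡ true

allB : (ℕ → Bool) → List ℕ → Bool
allB p [] = true
allB p (y ∷ ys) = p y ∧ allB p ys

anyB : (ℕ → Bool) → List ℕ → Bool
anyB p [] = false
anyB p (y ∷ ys) = p y ∨ anyB p ys

fitsB : List ℕ → ℕ → Bool
fitsB Y L = anyB (λ a → allB (inIntvB a L) Y) (upTo 7)

-- ℓ(Y): least L ≥ 0 such that Y fits in an interval of length L
-- (search L = 0,1,2,…; L = 7 always works for Y ⊆ ℤ_7)
ℓsearch : ℕ → ℕ → List ℕ → ℕ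
ℓsearch L zero Y = L
ℓsearch L (suc fuel) Y = if fitsB Y L then L else ℓsearch (suc L) fuel Y

ℓ : List ℕ → ℕ
ℓ Y = ℓsearch 0 7 Y

ℓZ : ℕ → List ℤ → ℕ
ℓZ m X = ℓ (map (q m) X)

ẽ : ℕ → ℤ → ℤ → ℕ
ẽ m d d' = ((2 ℕ.* q m d ℕ.+ 7) ∸ q m d') ℕ.% 7

module Submission where

-- Put P = 7^m.  For k ∈ ℕ the integer λ = 1 + k·P is a multiplier
-- (its inverse modulo N = 7^(m+1) is 1 - k·P, because N ∣ P² when m ≥ 1), and it
-- moves the digit q by a multiple of the residue modulo 7:
--     q(λ·x) ≡ q(x) + k·(x mod 7)   (mod 7).
-- Since |A₁| + |A₂| = 5 = |A|, the class A₄ is empty, so λ shifts q by k·s on A₁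
-- and by 2·k·s on A₂ = {d', d''}.  Hence it suffices to find k ∈ {0,…,6} moving
-- the interval {q(d), …, q(d)+ℓ(A₁)-1} and the two values q(d'), q(d'') off {0,6}.
-- Whether such k exists depends only on (s, q(d), q(d'), q(d''), ℓ(A₁)), a finite
-- amount of data, and under (i) or (ii) it is checked by evaluating a Boolean table.

open import Defs
open import Data.Nat using (ℕ; _≤_; _≥_)
open import Data.Integer using (ℤ; _*_)
open import Data.List using (List; length; map)
open import Data.List.Membership.Propositional using (_∈_)
open import Data.List.Relation.Unary.All using (All)
open import Data.List.Relation.Unary.Unique.Propositional using (Unique)
open import Data.Integer.Divisibility using () renaming (_∣_ to _∣ℤ_)
open import Data.Product using (Σ; _×_)
open import Data.Sum using (_⊎_)
open import Relation.Binary.PropositionalEquality using (_≡_; _≢_)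
open import Relation.Nullary using (¬_)
open import Data.Integer using (+_)

open import Data.Nat as ℕ using (suc; z≤n; s≤s; _≡ᵇ_; _≤ᵇ_; _≟_)
import Data.Nat.Properties as ℕP
import Data.Nat.DivMod as ℕD
open import Data.Nat.Divisibility using (_∣_; divides)
open import Data.Nat.Solver using (module +-*-Solver)
open import Data.Integer as ℤ using (_+_; _-_; -_; _/ℕ_; _%ℕ_)
import Data.Integer.Properties as ℤP
open import Data.Integer.DivMod using (a≡a%ℕn+[a/ℕn]*n; n%ℕd<d)
open import Data.Integer.Tactic.RingSolver using (solve-∀)
open import Algebra.Bundles using (AbelianGroup)
open import Algebra.Properties.Group (AbelianGroup.group ℤP.+-0-abelianGroup) using (∙-cancelʳ)
open import Data.Bool using (Bool; true; false; not; _∧_; _∨_; T)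
open import Data.Unit using (tt)
open import Data.List using ([]; _∷_; upTo)
open import Data.List.Relation.Unary.Any using (here; there)
import Data.List.Relation.Unary.All as All
open import Data.List.Membership.Propositional.Properties
  using (∈-upTo⁺; ∈-filter⁺; ∈-filter⁻; ∈-map⁺)
open import Data.Product using (_,_; proj₁; proj₂)
open import Data.Sum using (inj₁; inj₂)
open import Data.Empty using (⊥; ⊥-elim)
open import Relation.Binary.PropositionalEquality
  using (refl; sym; trans; cong; cong₂; subst; module ≡-Reasoning)

module _ (d : ℕ) .{{_ : ℕ.NonZero d}} where

  quotient-≤ : ∀ r c r′ c′ → r′ ℕ.< d → + r + c * + d ≡ + r′ + c′ * + d → c ℤ.≤ c′
  quotient-≤ r c r′ c′ r′<d eq = ℤP.≮⇒≥ (λ c′<c → ℤP.<-irrefl refl (too-big c′<c))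
    where
    open ℤP.≤-Reasoning
    too-big : c′ ℤ.< c → + r′ + c′ * + d ℤ.< + r′ + c′ * + d
    too-big c′<c = begin-strict
      + r′ + c′ * + d   <⟨ ℤP.+-monoˡ-< (c′ * + d) (ℤ.+<+ r′<d) ⟩
      + d + c′ * + d    ≡⟨ ℤP.suc-* c′ (+ d) ⟨
      ℤ.suc c′ * + d    ≤⟨ ℤP.*-monoʳ-≤-nonNeg (+ d) (ℤP.i<j⇒suc[i]≤j c′<c) ⟩
      c * + d           ≤⟨ ℤP.i≤j+i (c * + d) (+ r) ⟩
      + r + c * + d     ≡⟨ eq ⟩
      + r′ + c′ * + d   ∎

  divmod-unique : ∀ x r c → r ℕ.< d → x ≡ + r + c * + d → x /ℕ d ≡ c × x %ℕ d ≡ r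
  divmod-unique x r c r<d x≡ = quot , rem
    where
    two-ways : + r + c * + d ≡ + (x %ℕ d) + (x /ℕ d) * + d
    two-ways = trans (sym x≡) (a≡a%ℕn+[a/ℕn]*n x d)
    quot : x /ℕ d ≡ c
    quot = ℤP.≤-antisym (quotient-≤ _ _ r c r<d (sym two-ways))
                        (quotient-≤ r c _ _ (n%ℕd<d x d) two-ways)
    rem : x %ℕ d ≡ r
    rem = sym (ℤP.+-injective (∙-cancelʳ (c * + d) _ _
            (trans two-ways (cong (λ z → + (x %ℕ d) + z * + d) quot))))

quotient-shift : ∀ x y d .{{_ : ℕ.NonZero d}} → (x + y * + d) /ℕ d ≡ x /ℕ d + y
quotient-shift x y d = proj₁ (divmod-unique d _ (x %ℕ d) (x /ℕ d + y) (n%ℕd<d x d) expand)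
  where
  regroup : ∀ r c y d → (r + c * d) + y * d ≡ r + (c + y) * d
  regroup = solve-∀
  expand : x + y * + d ≡ + (x %ℕ d) + (x /ℕ d + y) * + d
  expand = trans (cong (_+ y * + d) (a≡a%ℕn+[a/ℕn]*n x d)) (regroup (+ (x %ℕ d)) (x /ℕ d) y (+ d))

remainder-linear : ∀ a k x d .{{_ : ℕ.NonZero d}} →
  (a + + k * x) %ℕ d ≡ (a %ℕ d ℕ.+ k ℕ.* (x %ℕ d)) ℕ.% d
remainder-linear a k x d =
  proj₂ (divmod-unique d _ (n ℕ.% d) (+ (n ℕ./ d) + (a /ℕ d + + k * (x /ℕ d))) (ℕD.m%n<n n d) expand)
  where
  n = a %ℕ d ℕ.+ k ℕ.* (x %ℕ d)
  collect : ∀ ra ca k rx cx d → (ra + ca * d) + k * (rx + cx * d) ≡ (ra + k * rx) + (ca + k * cx) * d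
  collect = solve-∀
  regroup : ∀ r c e d → (r + c * d) + e * d ≡ r + (c + e) * d
  regroup = solve-∀
  embed : + n ≡ + (a %ℕ d) + + k * + (x %ℕ d)
  embed = trans (ℤP.pos-+ (a %ℕ d) _) (cong (_+_ (+ (a %ℕ d))) (ℤP.pos-* k (x %ℕ d)))
  open ≡-Reasoning
  expand : a + + k * x ≡ + (n ℕ.% d) + (+ (n ℕ./ d) + (a /ℕ d + + k * (x /ℕ d))) * + d
  expand = begin
    a + + k * x
      ≡⟨ cong₂ (λ u v → u + + k * v) (a≡a%ℕn+[a/ℕn]*n a d) (a≡a%ℕn+[a/ℕn]*n x d) ⟩
    (+ (a %ℕ d) + a /ℕ d * + d) + + k * (+ (x %ℕ d) + x /ℕ d * + d)
      ≡⟨ collect (+ (a %ℕ d)) (a /ℕ d) (+ k) (+ (x %ℕ d)) (x /ℕ d) (+ d) ⟩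
    (+ (a %ℕ d) + + k * + (x %ℕ d)) + (a /ℕ d + + k * (x /ℕ d)) * + d
      ≡⟨ cong (_+ (a /ℕ d + + k * (x /ℕ d)) * + d) (sym embed) ⟩
    + n + (a /ℕ d + + k * (x /ℕ d)) * + d
      ≡⟨ cong (_+ (a /ℕ d + + k * (x /ℕ d)) * + d) (a≡a%ℕn+[a/ℕn]*n (+ n) d) ⟩
    (+ (n ℕ.% d) + + (n ℕ./ d) * + d) + (a /ℕ d + + k * (x /ℕ d)) * + d
      ≡⟨ regroup (+ (n ℕ.% d)) (+ (n ℕ./ d)) (a /ℕ d + + k * (x /ℕ d)) (+ d) ⟩
    + (n ℕ.% d) + (+ (n ℕ./ d) + (a /ℕ d + + k * (x /ℕ d))) * + d ∎

q-shift : ∀ m k x → q m ((+ 1 + + k * + (7 ℕ.^ m)) * x) ≡ (q m x ℕ.+ k ℕ.* res7 x) ℕ.% 7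
q-shift m k x = begin
  ((+ 1 + + k * + P) * x) /ℕ P %ℕ 7   ≡⟨ cong (λ z → z /ℕ P %ℕ 7) (distribute (+ k) (+ P) x) ⟩
  (x + (+ k * x) * + P) /ℕ P %ℕ 7     ≡⟨ cong (_%ℕ 7) (quotient-shift x (+ k * x) P) ⟩
  (x /ℕ P + + k * x) %ℕ 7             ≡⟨ remainder-linear (x /ℕ P) k x 7 ⟩
  (q m x ℕ.+ k ℕ.* res7 x) ℕ.% 7      ∎
  where
  open ≡-Reasoning
  P = 7 ℕ.^ m
  instance
    P≢0 : ℕ.NonZero P
    P≢0 = ℕP.m^n≢0 7 m
  distribute : ∀ k P x → (+ 1 + k * P) * x ≡ x + (k * x) * P
  distribute = solve-∀

-- For m ≥ 1, λ = 1 + k·7^m is invertible modulo 7^(m+1) with inverse 1 - k·7^m: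
-- λ·(1 - k·7^m) - 1 = -(k·7^m)², and 7^(m+1) divides 7^(2m).
shift-multiplier : ∀ m k → 1 ≤ m → Multiplier m (+ 1 + + k * + (7 ℕ.^ m))
shift-multiplier (suc m) k _ = + 1 - + k * + P , subst (+ Nmod (suc m) ∣ℤ_) (sym product) N∣square
  where
  open +-*-Solver
  P = 7 ℕ.^ suc m
  Q = 7 ℕ.^ m
  difference-of-squares : ∀ K → (+ 1 + K) * (+ 1 - K) - + 1 ≡ - (K * K)
  difference-of-squares = solve-∀
  product : (+ 1 + + k * + P) * (+ 1 - + k * + P) - + 1 ≡ - + (k ℕ.* P ℕ.* (k ℕ.* P))
  product = trans (difference-of-squares (+ k * + P))
    (cong -_ (trans (cong₂ _*_ (sym (ℤP.pos-* k P)) (sym (ℤP.pos-* k P)))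
                    (sym (ℤP.pos-* (k ℕ.* P) (k ℕ.* P)))))
  square : k ℕ.* (7 ℕ.* Q) ℕ.* (k ℕ.* (7 ℕ.* Q)) ≡ (k ℕ.* k ℕ.* Q) ℕ.* (7 ℕ.* (7 ℕ.* Q))
  square = solve 2 (λ k Q → k :* (con 7 :* Q) :* (k :* (con 7 :* Q))
                         := (k :* k :* Q) :* (con 7 :* (con 7 :* Q))) refl k Q
  N∣square : + Nmod (suc m) ∣ℤ - + (k ℕ.* P ℕ.* (k ℕ.* P))
  N∣square = subst (Nmod (suc m) ∣_) (sym (ℤP.∣-i∣≡∣i∣ (+ _))) (divides (k ℕ.* k ℕ.* Q) square)

Avoids06 : ℕ → Set
Avoids06 v = v ≢ 0 × v ≢ 6

avoids06 : ℕ → Bool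
avoids06 v = not (v ≡ᵇ 0) ∧ not (v ≡ᵇ 6)

avoids06-sound : ∀ v → avoids06 v ≡ true → Avoids06 v
avoids06-sound v ok = (λ { refl → no-false ok }) , (λ { refl → no-false ok })
  where
  no-false : ¬ (false ≡ true)
  no-false ()

∧-true : ∀ {a b} → a ∧ b ≡ true → a ≡ true × b ≡ true
∧-true {true} b≡true = refl , b≡true

implies : ∀ {a b} → not a ∨ b ≡ true → a ≡ true → b ≡ true
implies b≡true refl = b≡true

allB-∈ : ∀ {p : ℕ → Bool} {ys y} → allB p ys ≡ true → y ∈ ys → p y ≡ true
allB-∈ {p} {y ∷ _} all (here refl) = proj₁ (∧-true {p y} all)
allB-∈ {p} {y ∷ _} all (there y∈) = allB-∈ (proj₂ (∧-true {p y} all)) y∈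

anyB-witness : ∀ {p : ℕ → Bool} ys → anyB p ys ≡ true → Σ ℕ (λ k → k ∈ ys × p k ≡ true)
anyB-witness {p} (y ∷ ys) any with p y in py
... | true  = y , here refl , py
... | false with anyB-witness ys any
...   | k , k∈ , pk = k , there k∈ , pk

withRes-residue : ∀ {r x} A → x ∈ withRes r A → res7 x ≡ r
withRes-residue {r} A x∈ = proj₂ (∈-filter⁻ (λ y → res7 y ≟ r) {xs = A} x∈)

≡ᵇ-sound : ∀ u v → (u ≡ᵇ v) ≡ true → u ≡ v
≡ᵇ-sound u v u≡ᵇv = ℕP.≡ᵇ⇒≡ u v (subst T (sym u≡ᵇv) tt)

count-classes : ∀ a b c → a ≢ b → a ≢ c → b ≢ c → (A : List ℤ) →
  length (withRes a A) ℕ.+ length (withRes b A) ℕ.+ length (withRes c A) ≤ length A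
count-classes a b c a≢b a≢c b≢c [] = z≤n
count-classes a b c a≢b a≢c b≢c (x ∷ xs)
  with res7 x ≡ᵇ a in x∈a | res7 x ≡ᵇ b in x∈b | res7 x ≡ᵇ c in x∈c
     | count-classes a b c a≢b a≢c b≢c xs
... | true  | true  | _     | _ = ⊥-elim (a≢b (trans (sym (≡ᵇ-sound (res7 x) a x∈a)) (≡ᵇ-sound (res7 x) b x∈b)))
... | true  | false | true  | _ = ⊥-elim (a≢c (trans (sym (≡ᵇ-sound (res7 x) a x∈a)) (≡ᵇ-sound (res7 x) c x∈c)))
... | false | true  | true  | _ = ⊥-elim (b≢c (trans (sym (≡ᵇ-sound (res7 x) b x∈b)) (≡ᵇ-sound (res7 x) c x∈c)))
... | true  | false | false | ih = s≤s ih
... | false | true  | false | ih = subst (ℕ._≤ suc (length xs))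
  (cong (ℕ._+ length (withRes c xs)) (sym (ℕP.+-suc _ _))) (s≤s ih)
... | false | false | true  | ih = subst (ℕ._≤ suc (length xs)) (sym (ℕP.+-suc _ _)) (s≤s ih)
... | false | false | false | ih = ℕP.m≤n⇒m≤1+n ih

residue-classes : ∀ s r → (s ≡ 1 ⊎ s ≡ 2 ⊎ s ≡ 4) → (r ≡ 1 ⊎ r ≡ 2 ⊎ r ≡ 4) →
  r ≡ s ℕ.% 7 ⊎ r ≡ (2 ℕ.* s) ℕ.% 7 ⊎ r ≡ (4 ℕ.* s) ℕ.% 7
residue-classes .1 .1 (inj₁ refl)        (inj₁ refl)        = inj₁ refl
residue-classes .1 .2 (inj₁ refl)        (inj₂ (inj₁ refl)) = inj₂ (inj₁ refl)
residue-classes .1 .4 (inj₁ refl)        (inj₂ (inj₂ refl)) = inj₂ (inj₂ refl)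
residue-classes .2 .1 (inj₂ (inj₁ refl)) (inj₁ refl)        = inj₂ (inj₂ refl)
residue-classes .2 .2 (inj₂ (inj₁ refl)) (inj₂ (inj₁ refl)) = inj₁ refl
residue-classes .2 .4 (inj₂ (inj₁ refl)) (inj₂ (inj₂ refl)) = inj₂ (inj₁ refl)
residue-classes .4 .1 (inj₂ (inj₂ refl)) (inj₁ refl)        = inj₂ (inj₁ refl)
residue-classes .4 .2 (inj₂ (inj₂ refl)) (inj₂ (inj₁ refl)) = inj₂ (inj₂ refl)
residue-classes .4 .4 (inj₂ (inj₂ refl)) (inj₂ (inj₂ refl)) = inj₁ refl

classes-distinct : ∀ s → (s ≡ 1 ⊎ s ≡ 2 ⊎ s ≡ 4) →
  (s ℕ.% 7 ≢ (2 ℕ.* s) ℕ.% 7) × (s ℕ.% 7 ≢ (4 ℕ.* s) ℕ.% 7) × ((2 ℕ.* s) ℕ.% 7 ≢ (4 ℕ.* s) ℕ.% 7)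
classes-distinct .1 (inj₁ refl)        = (λ ()) , (λ ()) , (λ ())
classes-distinct .2 (inj₂ (inj₁ refl)) = (λ ()) , (λ ()) , (λ ())
classes-distinct .4 (inj₂ (inj₂ refl)) = (λ ()) , (λ ()) , (λ ())

no-members : ∀ {x : ℤ} {xs} → length xs ≤ 0 → ¬ (x ∈ xs)
no-members {xs = []} _ ()

A₁-or-A₂ : ∀ A s → (s ≡ 1 ⊎ s ≡ 2 ⊎ s ≡ 4) →
  All (λ x → res7 x ≡ 1 ⊎ res7 x ≡ 2 ⊎ res7 x ≡ 4) A →
  length (A₁ s A) ℕ.+ length (A₂ s A) ≡ length A →
  ∀ {x} → x ∈ A → x ∈ A₁ s A ⊎ x ∈ A₂ s A
A₁-or-A₂ A s s-cases resA sizes {x} x∈A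
  with residue-classes s (res7 x) s-cases (All.lookup resA x∈A)
... | inj₁ r≡s        = inj₁ (∈-filter⁺ (λ y → res7 y ≟ s ℕ.% 7) x∈A r≡s)
... | inj₂ (inj₁ r≡2s) = inj₂ (∈-filter⁺ (λ y → res7 y ≟ (2 ℕ.* s) ℕ.% 7) x∈A r≡2s)
... | inj₂ (inj₂ r≡4s) = ⊥-elim (A₄-empty (∈-filter⁺ (λ y → res7 y ≟ (4 ℕ.* s) ℕ.% 7) x∈A r≡4s))
  where
  distinct = classes-distinct s s-cases
  |A₄|≤0 : length (A₄ s A) ≤ 0
  |A₄|≤0 = ℕP.+-cancelˡ-≤ (length A) (length (A₄ s A)) 0 (begin
    length A ℕ.+ length (A₄ s A)
      ≡⟨ cong (ℕ._+ length (A₄ s A)) sizes ⟨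
    length (A₁ s A) ℕ.+ length (A₂ s A) ℕ.+ length (A₄ s A)
      ≤⟨ count-classes _ _ _ (proj₁ distinct) (proj₁ (proj₂ distinct)) (proj₂ (proj₂ distinct)) A ⟩
    length A
      ≡⟨ ℕP.+-identityʳ (length A) ⟨
    length A ℕ.+ 0 ∎)
    where open ℕP.≤-Reasoning
  A₄-empty : ¬ (x ∈ A₄ s A)
  A₄-empty = no-members |A₄|≤0

other-element : (d′ : ℤ) (B : List ℤ) → length B ≡ 2 → d′ ∈ B →
  Σ ℤ (λ d″ → ∀ {x} → x ∈ B → x ≡ d′ ⊎ x ≡ d″)
other-element d′ (_ ∷ b ∷ []) _ (here refl) = b , λ { (here e) → inj₁ e ; (there (here e)) → inj₂ e }
other-element d′ (a ∷ _ ∷ []) _ (there (here refl)) = a , λ { (here e) → inj₂ e ; (there (here e)) → inj₁ e }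

-- The digit y of an element of residue r after multiplication by 1 + k·7^m (cf. q-shift).
shifted : ℕ → ℕ → ℕ → ℕ
shifted r k y = (y ℕ.+ k ℕ.* r) ℕ.% 7

record GoodShift (s qd L q₁ q₂ k : ℕ) : Set where
  field
    interval : ∀ y → y ℕ.< 7 → InIntv qd L y → Avoids06 (shifted (s ℕ.% 7) k y)
    first    : Avoids06 (shifted ((2 ℕ.* s) ℕ.% 7) k q₁)
    second   : Avoids06 (shifted ((2 ℕ.* s) ℕ.% 7) k q₂)

intervalOkB : ℕ → ℕ → ℕ → ℕ → ℕ → Bool
intervalOkB s qd L k y = not (inIntvB qd L y) ∨ avoids06 (shifted (s ℕ.% 7) k y)

goodShiftB : ℕ → ℕ → ℕ → ℕ → ℕ → ℕ → Bool
goodShiftB s qd L q₁ q₂ k =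
  allB (intervalOkB s qd L k) (upTo 7)
  ∧ (avoids06 (shifted ((2 ℕ.* s) ℕ.% 7) k q₁) ∧ avoids06 (shifted ((2 ℕ.* s) ℕ.% 7) k q₂))

goodShiftB-sound : ∀ s qd L q₁ q₂ k → goodShiftB s qd L q₁ q₂ k ≡ true → GoodShift s qd L q₁ q₂ k
goodShiftB-sound s qd L q₁ q₂ k ok = record
  { interval = λ y y<7 y∈ → avoids06-sound _
      (implies {inIntvB qd L y} (allB-∈ {intervalOkB s qd L k} on-interval (∈-upTo⁺ y<7)) y∈)
  ; first    = avoids06-sound _ (proj₁ (∧-true {avoids06 (shifted s₂ k q₁)} on-A₂))
  ; second   = avoids06-sound _ (proj₂ (∧-true {avoids06 (shifted s₂ k q₁)} on-A₂))
  }
  where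
  s₂ = (2 ℕ.* s) ℕ.% 7
  on-interval = proj₁ (∧-true {allB (intervalOkB s qd L k) (upTo 7)} ok)
  on-A₂       = proj₂ (∧-true {allB (intervalOkB s qd L k) (upTo 7)} ok)

-- Hypotheses (i)/(ii) in terms of qd = q(d), L = ℓ(A₁), q₁ = q(d′).
hypothesisB : ℕ → ℕ → ℕ → Bool
hypothesisB qd L q₁ = (L ≤ᵇ 3) ∨ ((L ≡ᵇ 4) ∧ ((e ≡ᵇ 0) ∨ ((e ≡ᵇ 1) ∨ (e ≡ᵇ 6))))
  where
  e = ((2 ℕ.* qd ℕ.+ 7) ℕ.∸ q₁) ℕ.% 7

-- The finite verification: for every s ∈ {1,2,4}, digits qd, q₁, q₂ and length
-- L ≤ 4 satisfying (i) or (ii), some k ∈ {0,…,6} is a good shift.  (As k varies,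
-- c = qd + k·s runs over ℤ₇ and the A₂-digits become 2c - ẽ; under (i) each ẽ rules
-- out at most one of c = 1, 2, 3, under (ii) ẽ(d,d′) rules out neither of c = 1, 2.)
tableEntry : ℕ → ℕ → ℕ → ℕ → ℕ → Bool
tableEntry s qd q₁ q₂ L = not (hypothesisB qd L q₁) ∨ anyB (goodShiftB s qd L q₁ q₂) (upTo 7)

allL : ℕ → ℕ → ℕ → ℕ → Bool
allL s qd q₁ q₂ = allB (tableEntry s qd q₁ q₂) (upTo 5)

allQ₂ : ℕ → ℕ → ℕ → Bool
allQ₂ s qd q₁ = allB (allL s qd q₁) (upTo 7)

allQ₁ : ℕ → ℕ → Bool
allQ₁ s qd = allB (allQ₂ s qd) (upTo 7)

allQd : ℕ → Bool
allQd s = allB (allQ₁ s) (upTo 7)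

shiftTable : Bool
shiftTable = allB allQd (1 ∷ 2 ∷ 4 ∷ [])

shiftTable-holds : shiftTable ≡ true
shiftTable-holds = refl

good-shift-exists : ∀ s qd L q₁ q₂ → s ∈ (1 ∷ 2 ∷ 4 ∷ []) →
  qd ℕ.< 7 → L ℕ.< 5 → q₁ ℕ.< 7 → q₂ ℕ.< 7 → hypothesisB qd L q₁ ≡ true →
  Σ ℕ (GoodShift s qd L q₁ q₂)
good-shift-exists s qd L q₁ q₂ s∈ qd<7 L<5 q₁<7 q₂<7 hyp =
  k , goodShiftB-sound s qd L q₁ q₂ k (proj₂ (proj₂ witness))
  where
  entry : tableEntry s qd q₁ q₂ L ≡ true
  entry = allB-∈ {tableEntry s qd q₁ q₂} (allB-∈ {allL s qd q₁} (allB-∈ {allQ₂ s qd}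
            (allB-∈ {allQ₁ s} (allB-∈ {allQd} shiftTable-holds s∈)
              (∈-upTo⁺ qd<7)) (∈-upTo⁺ q₁<7)) (∈-upTo⁺ q₂<7)) (∈-upTo⁺ L<5)
  witness = anyB-witness {goodShiftB s qd L q₁ q₂} (upTo 7) (implies {hypothesisB qd L q₁} entry hyp)
  k = proj₁ witness

q<7 : ∀ m x → q m x ℕ.< 7
q<7 m x = n%ℕd<d ((x /ℕ (7 ℕ.^ m)) {{ℕP.m^n≢0 7 m}}) 7

s-listed : ∀ s → (s ≡ 1 ⊎ s ≡ 2 ⊎ s ≡ 4) → s ∈ (1 ∷ 2 ∷ 4 ∷ [])
s-listed .1 (inj₁ refl)        = here refl
s-listed .2 (inj₂ (inj₁ refl)) = there (here refl)
s-listed .4 (inj₂ (inj₂ refl)) = there (there (here refl))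

Hypothesis : ℕ → ℕ → Set
Hypothesis L e = L ≤ 3 ⊎ (L ≡ 4 × (e ≡ 0 ⊎ e ≡ 1 ⊎ e ≡ 6))

hypothesis-bound : ∀ {L e} → Hypothesis L e → L ℕ.< 5
hypothesis-bound (inj₁ L≤3)        = s≤s (ℕP.m≤n⇒m≤1+n L≤3)
hypothesis-bound (inj₂ (refl , _)) = ℕP.≤-refl

hypothesis-holds : ∀ qd L q₁ → Hypothesis L (((2 ℕ.* qd ℕ.+ 7) ℕ.∸ q₁) ℕ.% 7) →
  hypothesisB qd L q₁ ≡ true
hypothesis-holds qd L q₁ (inj₁ L≤3) with L ≤ᵇ 3 | ℕP.≤⇒≤ᵇ L≤3
... | true  | _  = refl
... | false | ()
hypothesis-holds qd .4 q₁ (inj₂ (refl , e-cases)) with e-cases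
... | inj₁ e≡0 rewrite e≡0 = refl
... | inj₂ (inj₁ e≡1) rewrite e≡1 = refl
... | inj₂ (inj₂ e≡6) rewrite e≡6 = refl

lemma9 : (m : ℕ) → m ≥ 2 →
    (A : List ℤ) → Unique A → length A ≡ 5 →
    All (λ x → ¬ ((+ 7) ∣ℤ x)) A →
    All (λ x → res7 x ≡ 1 ⊎ res7 x ≡ 2 ⊎ res7 x ≡ 4) A →
    (s : ℕ) → (s ≡ 1 ⊎ s ≡ 2 ⊎ s ≡ 4) →
    (∀ t → (t ≡ 1 ⊎ t ≡ 2 ⊎ t ≡ 4) → length (withRes t A) ≤ length (withRes s A)) →
    length (A₁ s A) ≡ 3 → length (A₂ s A) ≡ 2 →
    (d : ℤ) → d ∈ A₁ s A →
    All (InIntv (q m d) (ℓZ m (A₁ s A))) (map (q m) (A₁ s A)) →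
    (d' : ℤ) → d' ∈ A₂ s A →
    (ℓZ m (A₁ s A) ≤ 3
    ⊎ (ℓZ m (A₁ s A) ≡ 4 × (ẽ m d d' ≡ 0 ⊎ ẽ m d d' ≡ 1 ⊎ ẽ m d d' ≡ 6))) →
    Σ ℤ (λ λ' → Multiplier m λ' ×
    All (λ x → q m (λ' * x) ≢ 0 × q m (λ' * x) ≢ 6) A)
lemma9 m m≥2 A _ |A|≡5 _ resA s s-cases _ |A₁|≡3 |A₂|≡2 d _ A₁-fits d' d'∈A₂ hyp =
  + 1 + + k * + (7 ℕ.^ m) , shift-multiplier m k (ℕP.<⇒≤ m≥2) , All.tabulate shifted-avoids
  where
  L = ℓZ m (A₁ s A)
  d″ = proj₁ (other-element d' (A₂ s A) |A₂|≡2 d'∈A₂)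
  A₂⊆ = proj₂ (other-element d' (A₂ s A) |A₂|≡2 d'∈A₂)
  shift = good-shift-exists s (q m d) L (q m d') (q m d″) (s-listed s s-cases) (q<7 m d)
            (hypothesis-bound hyp) (q<7 m d') (q<7 m d″) (hypothesis-holds (q m d) L (q m d') hyp)
  k = proj₁ shift
  open GoodShift (proj₂ shift)
  shifted-avoids : ∀ {x} → x ∈ A → Avoids06 (q m ((+ 1 + + k * + (7 ℕ.^ m)) * x))
  shifted-avoids {x} x∈A = subst Avoids06 (sym (q-shift m k x)) (by-class (A₁-or-A₂ A s s-cases resA
    (trans (cong₂ ℕ._+_ |A₁|≡3 |A₂|≡2) (sym |A|≡5)) x∈A))
    where
    digit-avoids : ℕ → ℤ → Set
    digit-avoids r z = Avoids06 (shifted r k (q m z))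
    on-A₂ : x ≡ d' ⊎ x ≡ d″ → digit-avoids ((2 ℕ.* s) ℕ.% 7) x
    on-A₂ (inj₁ x≡d') = subst (digit-avoids _) (sym x≡d') first
    on-A₂ (inj₂ x≡d″) = subst (digit-avoids _) (sym x≡d″) second
    by-class : x ∈ A₁ s A ⊎ x ∈ A₂ s A → digit-avoids (res7 x) x
    by-class (inj₁ x∈A₁) = subst (λ r → digit-avoids r x) (sym (withRes-residue A x∈A₁))
      (interval (q m x) (q<7 m x) (All.lookup A₁-fits (∈-map⁺ (q m) x∈A₁)))
    by-class (inj₂ x∈A₂) = subst (λ r → digit-avoids r x) (sym (withRes-residue A x∈A₂))
      (on-A₂ (A₂⊆ x∈A₂))
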